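{- Let $P$ be a polygon with vertex set $V$ and let $D$ be a dissection of $P$ of the form $D=\{d\}\sqcup D_2$, where $d=\{\zeta,\eta\}$ divides $P$ into subpolygons $P_1$ (vertex set $\{\varepsilon\in V : \zeta\le\varepsilon\le\eta\}$) and $P_2$ (vertex set $\{\varepsilon\in V:\eta\le\varepsilon\le\zeta\}$), and $D_2$ is a dissection of $P_2$. Let $U_1=\{\varepsilon\in V:\zeta<\varepsilon<\eta\}$ and $U_2=\{\varepsilon\in V:\eta<\varepsilon<\zeta\}$. If $\alpha\in U_1$, $\beta\in U_2$, and $\pi=(\pi_1,\dots,\pi_p)$ is a $T$-path from $\alpha$ to $\beta$ with respect to $D$, then $\pi_2\in\{\zeta,\eta\}$.
   Context: A polygon $P$ is a finite set $V$ of at least three vertices with a cyclic order, pictured as a convex polygon in the plane; for vertices $\zeta,\eta$, $\zeta\le\varepsilon\le\eta$ means $\varepsilon$ lies on the arc of the cyclic order going from $\zeta$ to $\eta$ in the positive direction, endpoints included, and strict inequality excludes the endpoints. A subpolygon is a subset of $V$ with at least three vertices and the induced cyclic order. A diagonal is a two-element subset of $V$. Edges are $\{\alpha,\alpha^+\}$; other diagonals are internal. Diagonals $\{\alpha,\beta\}$, $\{\gamma,\delta\}$ cross if the four vertices are distinct and appear in cyclic order $\alpha,\gamma,\beta,\delta$ or $\alpha,\delta,\beta,\gamma$. A dissection is a set of pairwise non-crossing internal diagonals. For vertices $\pi_1\neq\pi_p$, a $T$-path from $\pi_1$ to $\pi_p$ with respect to $D$ is a tuple $(\pi_1,\dots,\pi_p)$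 of vertices such that: (i) $\{\pi_1,\pi_2\},\dots,\{\pi_{p-1},\pi_p\}$ are pairwise different diagonals; (ii) no $\{\pi_i,\pi_{i+1}\}$ crosses a diagonal of $D$; (iii) each $\{\pi_{2j},\pi_{2j+1}\}$ lies in $D$, and these diagonals cross $\{\pi_1,\pi_p\}$ at pairwise different points progressing monotonically in the direction from $\pi_1$ to $\pi_p$. -}

module Defs where

open import Data.Nat using (ℕ; zero; suc; _+_; _∸_; _≤_; _<_; _≤ᵇ_)
open import Data.Fin using (Fin; toℕ)
open import Data.Bool using (if_then_else_)
open import Data.Product using (_×_; ∃; _,_)
open import Data.Sum using (_⊎_)
open import Data.Unit using (⊤)
open import Relation.Binary.PropositionalEquality using (_≡_; _≢_)
open import Relation.Nullary using (¬_)

-- A polygon with n vertices is modelled as Fin n with the cyclic order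
-- 0 → 1 → … → n-1 → 0 (positive direction = increasing index, mod n).

off : ∀ {n} → Fin n → Fin n → ℕ
off {n} a x = if toℕ a ≤ᵇ toℕ x then toℕ x ∸ toℕ a else (n + toℕ x) ∸ toℕ a

-- a ≤ x ≤ b : x on the arc from a to b (positive direction), endpoints included
Arc : ∀ {n} → Fin n → Fin n → Fin n → Set
Arc a x b = off a x ≤ off a b

-- a < x < b : same, endpoints excluded
OArc : ∀ {n} → Fin n → Fin n → Fin n → Set
OArc a x b = (0 < off a x) × (off a x < off a b)

VSet : ℕ → Set₁
VSet n = Fin n → Set

FullV : ∀ {n} → VSet n
FullV _ = ⊤

-- sets of diagonals: the diagonal {x,y} belongs to S iff S x y or S y x
DSet : ℕ → Set₁
DSet n = Fin n → Fin n → Set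

MemD : ∀ {n} → DSet n → Fin n → Fin n → Set
MemD S x y = S x y ⊎ S y x

SameDiag : ∀ {n} → Fin n → Fin n → Fin n → Fin n → Set
SameDiag x y u v = ((x ≡ u) × (y ≡ v)) ⊎ ((x ≡ v) × (y ≡ u))

AddDiag : ∀ {n} → Fin n → Fin n → DSet n → DSet n
AddDiag ζ η S x y = SameDiag x y ζ η ⊎ S x y

-- {a,b} and {c,d} cross: cyclic order a,c,b,d or a,d,b,c (four distinct vertices)
Cross : ∀ {n} → Fin n → Fin n → Fin n → Fin n → Set
Cross a b c d = (OArc a c b × OArc b d a) ⊎ (OArc a d b × OArc b c a)

-- {x,y} is an internal diagonal of the subpolygon with vertex set W
-- (two distinct vertices of W, not consecutive in the induced cyclic order)
InternalIn : ∀ {n} → VSet n → Fin n → Fin n → Set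
InternalIn W x y =
  W x × W y × (x ≢ y) × (∃ λ w → W w × OArc x w y) × (∃ λ w → W w × OArc y w x)

IsDissectionOf : ∀ {n} → VSet n → DSet n → Set
IsDissectionOf W S =
  (∀ x y → MemD S x y → InternalIn W x y) ×
  (∀ x y u v → MemD S x y → MemD S u v → ¬ Cross x y u v)

Oriented : ∀ {n} → Fin n → Fin n → Fin n → Fin n → Fin n → Fin n → Set
Oriented a b x y l r = SameDiag l r x y × OArc a l b × OArc b r a

-- For non-crossing diagonals {x1,y1}, {x2,y2} both crossing {a,b}:
-- {x1,y1} crosses {a,b} at a point strictly closer to a than {x2,y2} does.
Before : ∀ {n} → Fin n → Fin n → Fin n → Fin n → Fin n → Fin n → Set
Before a b x1 y1 x2 y2 =
  ∃ λ l1 → ∃ λ r1 → ∃ λ l2 → ∃ λ r2 →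
    Oriented a b x1 y1 l1 r1 × Oriented a b x2 y2 l2 r2 ×
    (off a l1 ≤ off a l2) × (off b r2 ≤ off b r1) × ¬ ((l1 ≡ l2) × (r1 ≡ r2))

-- T-path (π 0, …, π q) (i.e. p = q+1 vertices, 0-based) from π 0 to π q w.r.t. D.
-- Path edge i (0 ≤ i < q) is {π i, π (i+1)}; the paper's {π_{2j}, π_{2j+1}}
-- are the edges with odd 0-based index i = 2j+1.
record TPath {n : ℕ} (D : DSet n) (π : ℕ → Fin n) (q : ℕ) : Set where
  field
    ends-distinct : π 0 ≢ π q
    edge-diag     : ∀ i → i < q → π i ≢ π (suc i)
    edges-differ  : ∀ i j → i < j → j < q → ¬ SameDiag (π i) (π (suc i)) (π j) (π (suc j))
    no-cross      : ∀ i → i < q → ∀ x y → MemD D x y → ¬ Cross (π i) (π (suc i)) x y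
    -- (iii) the even (1-based) steps lie in D and cross {π₁, π_p}, monotonically
    even-in-D     : ∀ j → suc (j + j) < q → MemD D (π (suc (j + j))) (π (suc (suc (j + j))))
    even-cross    : ∀ j → suc (j + j) < q →
                      Cross (π (suc (j + j))) (π (suc (suc (j + j)))) (π 0) (π q)
    monotone      : ∀ j k → j < k → suc (k + k) < q →
                      Before (π 0) (π q)
                        (π (suc (j + j))) (π (suc (suc (j + j))))
                        (π (suc (k + k))) (π (suc (suc (k + k))))

module Submission where

-- Idea (vertices indexed from 0, so the path is π 0, …, π q).  Put
-- α = π 0 ∈ U₁.  The first edge {α, π 1} may not cross d ∈ D.  If the path
-- has a single edge then π 1 = β ∈ U₂ and {α,β} crosses d.  Otherwise the
-- second edge {π 1, π 2} lies in D = {d} ⊔ D₂: either it is d itself, or it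
-- is a diagonal of the dissection D₂ of P₂, so π 1 is a vertex of P₂, i.e.
-- π 1 ∈ {ζ,η} or π 1 ∈ U₂; in the last case {α, π 1} crosses d.

open import Defs
open import Data.Nat using (ℕ; _≤_)
open import Data.Fin using (Fin)
open import Data.Sum using (_⊎_)
open import Relation.Binary.PropositionalEquality using (_≡_)
open import Relation.Nullary using (¬_)

open import Data.Nat using (zero; suc; _+_; _∸_; _<_; s≤s; z≤n)
open import Data.Nat.Properties
open import Data.Fin using (toℕ)
open import Data.Fin.Properties using (toℕ<n; toℕ-injective)
import Data.Fin.Properties as Fin
open import Data.Bool using (Bool; true; false; T)
open import Data.Bool.Properties using (T-≡)
open import Function.Bundles using (Equivalence)
open import Data.Empty using (⊥-elim)
open import Data.Product using (_×_; _,_; proj₁)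
open import Data.Sum using (inj₁; inj₂)
open import Relation.Binary.PropositionalEquality using (refl; sym; trans)
open import Relation.Nullary using (yes; no; contradiction)

0<n∸m⇒m<n : ∀ {m n} → 0 < n ∸ m → m < n
0<n∸m⇒m<n p = ≰⇒> (λ n≤m → <-irrefl (sym (m≤n⇒m∸n≡0 n≤m)) p)

∸-reflectˡ-< : ∀ {m n o} → m ∸ o < n ∸ o → m < n
∸-reflectˡ-< {o = o} p = ≰⇒> (λ n≤m → <⇒≱ p (∸-monoˡ-≤ o n≤m))

¬T⇒≡false : ∀ {b : Bool} → ¬ T b → b ≡ false
¬T⇒≡false {false} _  = refl
¬T⇒≡false {true}  ¬t = contradiction _ ¬t

off-≤ : ∀ {n} {u v : Fin n} → toℕ u ≤ toℕ v → off u v ≡ toℕ v ∸ toℕ u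
off-≤ u≤v rewrite Equivalence.to T-≡ (≤⇒≤ᵇ u≤v) = refl

off-> : ∀ {n} {u v : Fin n} → toℕ v < toℕ u → off u v ≡ (n + toℕ v) ∸ toℕ u
off-> {u = u} {v} v<u rewrite ¬T⇒≡false (λ t → <⇒≱ v<u (≤ᵇ⇒≤ (toℕ u) (toℕ v) t)) = refl

data OffView {n : ℕ} (u v : Fin n) : Set where
  forward    : toℕ u ≤ toℕ v → off u v ≡ toℕ v ∸ toℕ u → OffView u v
  wraparound : toℕ v < toℕ u → off u v ≡ (n + toℕ v) ∸ toℕ u → OffView u v

offView : ∀ {n} (u v : Fin n) → OffView u v
offView u v with ≤-<-connex (toℕ u) (toℕ v)
... | inj₁ u≤v = forward u≤v (off-≤ u≤v)
... | inj₂ v<u = wraparound v<u (off-> v<u)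

index<n+ : ∀ {n} (u : Fin n) (m : ℕ) → toℕ u < n + m
index<n+ {n} u m = <-≤-trans (toℕ<n u) (m≤m+n n m)

forward<wraparound : ∀ {n u w v} → u ≤ w → w < n → w ∸ u < (n + v) ∸ u
forward<wraparound {n} {v = v} u≤w w<n = ∸-monoˡ-< (<-≤-trans w<n (m≤m+n n v)) u≤w

off≡0⇒≡ : ∀ {n} (u v : Fin n) → off u v ≡ 0 → v ≡ u
off≡0⇒≡ u v e with offView u v
... | forward u≤v ev = toℕ-injective (≤-antisym (m∸n≡0⇒m≤n (trans (sym ev) e)) u≤v)
... | wraparound _ ev =
  contradiction (m∸n≡0⇒m≤n (trans (sym ev) e))
                (<⇒≱ (index<n+ u (toℕ v)))

off-injective : ∀ {n} (u v w : Fin n) → off u v ≡ off u w → v ≡ w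
off-injective u v w e with offView u v | offView u w
... | forward u≤v ev | forward u≤w ew =
  toℕ-injective (∸-cancelʳ-≡ u≤v u≤w (trans (sym ev) (trans e ew)))
... | forward u≤v ev | wraparound _ ew =
  contradiction (trans (sym ev) (trans e ew)) (<⇒≢ (forward<wraparound u≤v (toℕ<n v)))
... | wraparound _ ev | forward u≤w ew =
  contradiction (trans (sym ew) (trans (sym e) ev)) (<⇒≢ (forward<wraparound u≤w (toℕ<n w)))
... | wraparound _ ev | wraparound _ ew =
  toℕ-injective (+-cancelˡ-≡ _ _ _
    (∸-cancelʳ-≡ (<⇒≤ (index<n+ u (toℕ v))) (<⇒≤ (index<n+ u (toℕ w)))
                 (trans (sym ev) (trans e ew))))

Cyc : ℕ → ℕ → ℕ → Set
Cyc u v w = ((u < v) × (v < w)) ⊎ ((v < w) × (w < u)) ⊎ ((w < u) × (u < v))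

oarc⇒cyc : ∀ {n} (u v w : Fin n) → OArc u v w → Cyc (toℕ u) (toℕ v) (toℕ w)
oarc⇒cyc {n} u v w (0<uv , uv<uw) with offView u v | offView u w
... | forward _ ev | forward _ ew rewrite ev | ew =
  inj₁ (0<n∸m⇒m<n 0<uv , ∸-reflectˡ-< {o = toℕ u} uv<uw)
... | forward _ ev | wraparound w<u _ rewrite ev =
  inj₂ (inj₂ (w<u , 0<n∸m⇒m<n 0<uv))
... | wraparound _ ev | forward u≤w ew rewrite ev | ew =
  contradiction uv<uw (<-asym (forward<wraparound u≤w (toℕ<n w)))
... | wraparound v<u ev | wraparound w<u ew rewrite ev | ew =
  inj₂ (inj₁ (+-cancelˡ-< n _ _ (∸-reflectˡ-< {o = toℕ u} uv<uw) , w<u))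

cyc⇒oarc : ∀ {n} (u v w : Fin n) → Cyc (toℕ u) (toℕ v) (toℕ w) → OArc u v w
cyc⇒oarc u v w (inj₁ (u<v , v<w))
  rewrite off-≤ {u = u} {v} (<⇒≤ u<v) | off-≤ {u = u} {w} (<⇒≤ (<-trans u<v v<w)) =
  m<n⇒0<n∸m u<v , ∸-monoˡ-< v<w (<⇒≤ u<v)
cyc⇒oarc {n} u v w (inj₂ (inj₁ (v<w , w<u)))
  rewrite off-> {u = u} {v} (<-trans v<w w<u) | off-> {u = u} {w} w<u =
  m<n⇒0<n∸m (index<n+ u (toℕ v)) ,
  ∸-monoˡ-< (+-monoʳ-< n v<w) (<⇒≤ (index<n+ u (toℕ v)))
cyc⇒oarc u v w (inj₂ (inj₂ (w<u , u<v)))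
  rewrite off-≤ {u = u} {v} (<⇒≤ u<v) | off-> {u = u} {w} w<u =
  m<n⇒0<n∸m u<v , forward<wraparound (<⇒≤ u<v) (toℕ<n v)

-- If a lies strictly between z and h, and x strictly between h and z, then
-- z, a, h, x occur in this cyclic order; in particular a, h, x do.
cyc-glue : ∀ {z a h x} → Cyc z a h → Cyc h x z → Cyc a h x
cyc-glue (inj₁ (z<a , a<h)) (inj₁ (h<x , x<z)) =
  contradiction (<-trans z<a a<h) (<-asym (<-trans h<x x<z))
cyc-glue (inj₁ (z<a , a<h)) (inj₂ (inj₁ (x<z , _))) = inj₂ (inj₂ (<-trans x<z z<a , a<h))
cyc-glue (inj₁ (_ , a<h)) (inj₂ (inj₂ (_ , h<x))) = inj₁ (a<h , h<x)
cyc-glue (inj₂ (inj₁ (a<h , _))) (inj₁ (h<x , _)) = inj₁ (a<h , h<x)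
cyc-glue (inj₂ (inj₁ (_ , h<z))) (inj₂ (inj₁ (_ , z<h))) = contradiction z<h (<-asym h<z)
cyc-glue (inj₂ (inj₁ (_ , h<z))) (inj₂ (inj₂ (z<h , _))) = contradiction z<h (<-asym h<z)
cyc-glue (inj₂ (inj₂ (h<z , z<a))) (inj₁ (h<x , x<z)) = inj₂ (inj₁ (h<x , <-trans x<z z<a))
cyc-glue (inj₂ (inj₂ (h<z , _))) (inj₂ (inj₁ (_ , z<h))) = contradiction z<h (<-asym h<z)
cyc-glue (inj₂ (inj₂ (h<z , _))) (inj₂ (inj₂ (z<h , _))) = contradiction z<h (<-asym h<z)

opposite-sides-cross : ∀ {n} {ζ η a x : Fin n} → OArc ζ a η → OArc η x ζ → Cross a x ζ η
opposite-sides-cross {ζ = ζ} {η} {a} {x} a∈U₁ x∈U₂ =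
  inj₂ ( cyc⇒oarc a η x (cyc-glue za-h hx-z)
       , cyc⇒oarc x ζ a (cyc-glue hx-z za-h) )
  where
  za-h : Cyc (toℕ ζ) (toℕ a) (toℕ η)
  za-h = oarc⇒cyc ζ a η a∈U₁
  hx-z : Cyc (toℕ η) (toℕ x) (toℕ ζ)
  hx-z = oarc⇒cyc η x ζ x∈U₂

arc-trichotomy : ∀ {n} (η x ζ : Fin n) → Arc η x ζ → (x ≡ ζ) ⊎ (x ≡ η) ⊎ OArc η x ζ
arc-trichotomy η x ζ x∈arc with x Fin.≟ ζ | x Fin.≟ η
... | yes x≡ζ | _       = inj₁ x≡ζ
... | no _    | yes x≡η = inj₂ (inj₁ x≡η)
... | no x≢ζ  | no x≢η  =
  inj₂ (inj₂ ( n≢0⇒n>0 (λ e → x≢η (off≡0⇒≡ η x e))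
             , ≤∧≢⇒< x∈arc (λ e → x≢ζ (off-injective η x ζ e)) ))

added-diagonal∈ : ∀ {n} {ζ η : Fin n} (S : DSet n) → MemD (AddDiag ζ η S) ζ η
added-diagonal∈ _ = inj₁ (inj₁ (inj₁ (refl , refl)))

endpoint-on-P₂-side : ∀ {n} {ζ η x y : Fin n} {D₂ : DSet n} →
  IsDissectionOf (λ ε → Arc η ε ζ) D₂ → MemD (AddDiag ζ η D₂) x y →
  (x ≡ ζ) ⊎ (x ≡ η) ⊎ OArc η x ζ
endpoint-on-P₂-side _ (inj₁ (inj₁ (inj₁ (x≡ζ , _)))) = inj₁ x≡ζ
endpoint-on-P₂-side _ (inj₁ (inj₁ (inj₂ (x≡η , _)))) = inj₂ (inj₁ x≡η)
endpoint-on-P₂-side _ (inj₂ (inj₁ (inj₁ (_ , x≡η)))) = inj₂ (inj₁ x≡η)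
endpoint-on-P₂-side _ (inj₂ (inj₁ (inj₂ (_ , x≡ζ)))) = inj₁ x≡ζ
endpoint-on-P₂-side {ζ = ζ} {η} {x} {y} dis₂ (inj₁ (inj₂ xy∈D₂)) =
  arc-trichotomy η x ζ (proj₁ (proj₁ dis₂ x y (inj₁ xy∈D₂)))
endpoint-on-P₂-side {ζ = ζ} {η} {x} {y} dis₂ (inj₂ (inj₂ yx∈D₂)) =
  arc-trichotomy η x ζ (proj₁ (proj₁ dis₂ x y (inj₂ yx∈D₂)))

first-step-not-across : ∀ {n} {D : DSet n} {π : ℕ → Fin n} {q : ℕ} {ζ η : Fin n} →
  TPath D π q → 0 < q → MemD D ζ η → OArc ζ (π 0) η → ¬ OArc η (π 1) ζ
first-step-not-across {π = π} {ζ = ζ} {η} tp 0<q d∈D π₀∈U₁ π₁∈U₂ =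
  TPath.no-cross tp 0 0<q ζ η d∈D
    (opposite-sides-cross {ζ = ζ} {η} {π 0} {π 1} π₀∈U₁ π₁∈U₂)

lemma3p7 : ∀ {n : ℕ} → 3 ≤ n → (ζ η : Fin n) → (D₂ : DSet n) →
    InternalIn FullV ζ η →
    IsDissectionOf FullV (AddDiag ζ η D₂) →
    ¬ MemD D₂ ζ η →
    IsDissectionOf (λ ε → Arc η ε ζ) D₂ →
    (α β : Fin n) → OArc ζ α η → OArc η β ζ →
    (π : ℕ → Fin n) (q : ℕ) → TPath (AddDiag ζ η D₂) π q →
    π 0 ≡ α → π q ≡ β →
    (π 1 ≡ ζ) ⊎ (π 1 ≡ η)
-- a path with no edge would start and end at the same vertex
lemma3p7 _ ζ η D₂ _ _ _ _ α β _ _ π zero tp refl refl =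
  ⊥-elim (TPath.ends-distinct tp refl)
-- a single edge {α,β} would cross d
lemma3p7 _ ζ η D₂ _ _ _ _ α β α∈U₁ β∈U₂ π (suc zero) tp refl refl =
  ⊥-elim (first-step-not-across tp (s≤s z≤n) (added-diagonal∈ D₂) α∈U₁ β∈U₂)
-- otherwise the second edge lies in D, so π 1 is ζ, η, or in U₂
lemma3p7 _ ζ η D₂ _ _ _ dis₂ α β α∈U₁ _ π (suc (suc _)) tp refl refl
  with endpoint-on-P₂-side dis₂ (TPath.even-in-D tp 0 (s≤s (s≤s z≤n)))
... | inj₁ π₁≡ζ          = inj₁ π₁≡ζ
... | inj₂ (inj₁ π₁≡η)   = inj₂ π₁≡η
... | inj₂ (inj₂ π₁∈U₂) =
  ⊥-elim (first-step-not-across tp (s≤s z≤n) (added-diagonal∈ D₂) α∈U₁ π₁∈U₂)
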